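{- Let $H$ be a hypergraph, $(Red,X,Blue)$ a partition of $V(H)$ such that no edge contains both a red and a blue vertex, and $F$ a reduced elimination forest of $H$. Let $U\subseteq Red\cup Blue$ be a context factor of $F$ with spine $P$ and appendices $W$, and let $P=P_1+\dots+P_q$ be the decomposition of $P$ into its colour intervals (in order from the root). Let $W_q=W$ and, for $1\le i\le q-1$, let $W_i$ be the singleton consisting of the first vertex of $P_{i+1}$. Then each interval factor $\mathrm{Cont}_F(P_i,W_i)$, $1\le i\le q$, is monochromatic.
   Context: Hypergraph: finite vertex set, edges non-empty subsets; vertices adjacent if some edge contains both. An elimination forest $F$ of $H$: rooted forest on $V(H)$ with vertices of a common edge in ancestor–descendant relation; $F_u$ = descendants of $u$ (including $u$). $F$ is reduced if every non-leaf $u$ is adjacent in $H$ to some vertex of $F_v$ for each child $v$ of $u$. Monochromatic: contained in $Red$ or in $Blue$. A context factor of $F$ is $F_x\setminus B$ where $B$ is a non-empty union of sets $F_y$ over sibling vertices $y$ that are strict descendants of $x$; the appendices are these $y$, and the spine is the path of $F$ from $x$ to the common parent of the appendices. A colour interval of $P$ is a maximal monochromatic subpath. For a directed path $P'$ whose last vertex is not a leaf and a non-empty set $W'$ of children of its last vertex, $\mathrm{Cont}_F(P',W')$ is $V(P')$ together with $F_u$ for every $u$ that is a child of a non-final vertex of $P'$ other than its successor on $P'$, or a child of the final vertex not in $W'$. -}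

module Defs where

open import Data.Nat using (ℕ)
open import Data.Fin using (Fin)
open import Data.Fin.Subset using (Subset; _∈_; _∉_; Nonempty)
open import Data.Maybe using (Maybe; just)
open import Data.List using (List)
import Data.List.Membership.Propositional as LM
open import Data.Product using (Σ; ∃; _×_; _,_)
open import Data.Sum using (_⊎_)
open import Relation.Binary.PropositionalEquality using (_≡_; _≢_)
open import Relation.Nullary using (¬_)

record Hypergraph (n : ℕ) : Set where
  field
    edges    : List (Subset n)
    nonempty : ∀ {e} → e LM.∈ edges → Nonempty e
open Hypergraph public

Adj : ∀ {n} → Hypergraph n → Fin n → Fin n → Set
Adj H u v = Σ (Subset _) λ e → e LM.∈ edges H × u ∈ e × v ∈ e

-- Rooted forests on Fin n, given by a parent function (roots have
-- parent nothing).

Parent : ℕ → Set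
Parent n = Fin n → Maybe (Fin n)

-- Anc par u v : u is an ancestor of v or u ≡ v, i.e. v ∈ F_u.
data Anc {n} (par : Parent n) (u : Fin n) : Fin n → Set where
  here : Anc par u u
  step : ∀ {v w} → par v ≡ just w → Anc par u w → Anc par u v

IsForest : ∀ {n} → Parent n → Set
IsForest par = ∀ u v → par v ≡ just u → ¬ Anc par v u

IsEliminationForest : ∀ {n} → Hypergraph n → Parent n → Set
IsEliminationForest H par =
  IsForest par ×
  (∀ {e} → e LM.∈ edges H → ∀ u v → u ∈ e → v ∈ e → Anc par u v ⊎ Anc par v u)

IsReduced : ∀ {n} → Hypergraph n → Parent n → Set
IsReduced H par = ∀ u v → par v ≡ just u → Σ _ λ w → Anc par v w × Adj H u w

data Colour : Set where
  red X blue : Colour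

ProperPartition : ∀ {n} → Hypergraph n → (Fin n → Colour) → Set
ProperPartition H col =
  ∀ {e} → e LM.∈ edges H → ∀ u v → u ∈ e → v ∈ e → col u ≡ red → col v ≢ blue

Monochromatic : ∀ {n} → (Fin n → Colour) → (Fin n → Set) → Set
Monochromatic col S = (∀ w → S w → col w ≡ red) ⊎ (∀ w → S w → col w ≡ blue)

-- Context factors.
-- Top vertex x, appendices W (non-empty set of siblings with common
-- parent p, strict descendants of x, i.e. p ∈ F_x).

IsContextFactor : ∀ {n} → Parent n → (x p : Fin n) → Subset n → Set
IsContextFactor par x p W =
  Nonempty W × (∀ y → y ∈ W → par y ≡ just p) × Anc par x p

ContextFactor : ∀ {n} → Parent n → Fin n → Subset n → Fin n → Set
ContextFactor par x W w = Anc par x w × ¬ (Σ _ λ y → y ∈ W × Anc par y w)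

OnPath : ∀ {n} → Parent n → Fin n → Fin n → Fin n → Set
OnPath par a b v = Anc par a v × Anc par v b

IsColourInterval : ∀ {n} → Parent n → (Fin n → Colour) →
                   (x p a b : Fin n) → Set
IsColourInterval par col x p a b =
  Anc par x a × Anc par a b × Anc par b p ×
  Monochromatic col (OnPath par a b) ×
  (∀ a' b' → Anc par x a' → Anc par a' a → Anc par b b' → Anc par b' p →
     Monochromatic col (OnPath par a' b') → a' ≡ a × b' ≡ b)

Cont : ∀ {n} → Parent n → (a b : Fin n) → (Fin n → Set) → Fin n → Set
Cont par a b W' w =
  OnPath par a b w ⊎
  (Σ _ λ u → Σ _ λ c → Anc par u w × par u ≡ just c ×
     ((OnPath par a b c × c ≢ b × ¬ (OnPath par a b u)) ⊎
      (c ≡ b × ¬ W' u)))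

-- The set W_i attached to the colour interval from a to b of the path
-- from x to p: W itself if the interval is the last one (b ≡ p), and
-- otherwise the singleton of the first vertex of the next interval,
-- i.e. the child of b on the path to p.
IntervalAppendices : ∀ {n} → Parent n → (p : Fin n) → Subset n →
                     (b : Fin n) → Fin n → Set
IntervalAppendices par p W b w =
  (b ≡ p × w ∈ W) ⊎ (b ≢ p × par w ≡ just b × Anc par w p)

-- A subtree F_t free of X-vertices is monochromatic: for a child c of t,
-- reducedness gives a vertex of F_c adjacent to t, which by properness has
-- the colour of t, and by induction over the (well-founded, as Fin n is
-- finite) descendant order it has the colour of c. For an interval factor,
-- every subtree hanging off the colour interval P_i lies inside U, so it
-- takes the colour of its attachment vertex on P_i, which is the colour of P_i.
module Submission where

open import Defs
open import Data.Nat using (ℕ)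
open import Data.Fin using (Fin; _≟_)
open import Data.Fin.Induction using (spo-noetherian)
open import Data.Fin.Subset using (Subset; _∈_; _∉_)
open import Data.Maybe using (just)
open import Data.Maybe.Properties using (just-injective)
open import Data.Product using (Σ; _×_; _,_; proj₁; proj₂)
open import Data.Sum using (_⊎_; inj₁; inj₂)
import Data.Sum as Sum
open import Data.Empty using (⊥; ⊥-elim)
open import Function using (flip)
open import Induction.WellFounded using (WellFounded; Acc; acc)
open import Relation.Binary.Structures using (IsStrictPartialOrder)
open import Relation.Nullary using (¬_; yes; no)
open import Relation.Binary.PropositionalEquality
  using (_≡_; _≢_; refl; sym; trans; subst; resp₂; isEquivalence; module ≡-Reasoning)

module _ {n : ℕ} {par : Parent n} where

  Anc-trans : ∀ {a b c} → Anc par a b → Anc par b c → Anc par a c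
  Anc-trans p here       = p
  Anc-trans p (step e q) = step e (Anc-trans p q)

  Anc-viewˡ : ∀ {a w} → Anc par a w → w ≡ a ⊎ Σ _ λ c → par c ≡ just a × Anc par c w
  Anc-viewˡ here = inj₁ refl
  Anc-viewˡ (step e p) with Anc-viewˡ p
  ... | inj₁ refl          = inj₂ (_ , e , here)
  ... | inj₂ (c , ec , cw) = inj₂ (c , ec , step e cw)

  Anc-parent : ∀ {a u c} → Anc par a u → par u ≡ just c → u ≡ a ⊎ Anc par a c
  Anc-parent here       _ = inj₁ refl
  Anc-parent (step e p) f with trans (sym f) e
  ... | refl = inj₂ p

  Anc-total : ∀ {a b w} → Anc par a w → Anc par b w → Anc par a b ⊎ Anc par b a
  Anc-total here       q            = inj₂ q
  Anc-total (step e p) here         = inj₁ (step e p)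
  Anc-total (step e p) (step e′ q) with trans (sym e) e′
  ... | refl = Anc-total p q

  StrictAnc : Fin n → Fin n → Set
  StrictAnc a b = Σ _ λ w → par b ≡ just w × Anc par a w

  module _ (forest : IsForest par) where

    Anc-antisym : ∀ {a b} → Anc par a b → Anc par b a → a ≡ b
    Anc-antisym here       _ = refl
    Anc-antisym (step e p) q = ⊥-elim (forest _ _ e (Anc-trans q p))

    StrictAnc-isStrictPartialOrder : IsStrictPartialOrder _≡_ StrictAnc
    StrictAnc-isStrictPartialOrder = record
      { isEquivalence = isEquivalence
      ; irrefl        = λ { refl (w , e , p) → forest w _ e p }
      ; trans         = λ { (_ , e , p) (w , e′ , q) → w , e′ , Anc-trans (step e p) q }
      ; <-resp-≈      = resp₂ StrictAnc
      }

    descendant-wellFounded : WellFounded (flip StrictAnc)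
    descendant-wellFounded = spo-noetherian StrictAnc-isStrictPartialOrder

module _ {n : ℕ} {par : Parent n} (forest : IsForest par)
         {p : Fin n} {W : Subset n} (W-children : ∀ y → y ∈ W → par y ≡ just p) where

  appendix-not-above : ∀ {y c} → y ∈ W → Anc par c p → ¬ Anc par y c
  appendix-not-above {y} y∈W cp yc = forest p y (W-children y y∈W) (Anc-trans yc cp)

  above-spine-end∈factor : ∀ {x c} → Anc par x c → Anc par c p → ContextFactor par x W c
  above-spine-end∈factor xc cp = xc , λ { (y , y∈W , yc) → appendix-not-above y∈W cp yc }

  branch⊆factor : ∀ {x c u} → Anc par x c → Anc par c p → par u ≡ just c →
                  u ∉ W → ¬ Anc par u p → ∀ w → Anc par u w → ContextFactor par x W w
  branch⊆factor {u = u} xc cp uc u∉W u↛p w uw =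
    Anc-trans xc (Anc-trans (step uc here) uw) , λ { (y , y∈W , yw) → y∤w y∈W (Anc-total yw uw) }
    where
    y∤w : ∀ {y} → y ∈ W → Anc par y u ⊎ Anc par u y → ⊥
    y∤w {y} y∈W (inj₁ yu) with Anc-parent yu uc
    ... | inj₁ u≡y = u∉W (subst (_∈ W) (sym u≡y) y∈W)
    ... | inj₂ yc  = appendix-not-above y∈W cp yc
    y∤w {y} y∈W (inj₂ uy) with Anc-parent uy (W-children y y∈W)
    ... | inj₁ y≡u = u∉W (subst (_∈ W) y≡u y∈W)
    ... | inj₂ up  = u↛p up

  module _ {a b : Fin n} (ab : Anc par a b) (bp : Anc par b p) where

    Branch : Fin n → Fin n → Set
    Branch u c = (OnPath par a b c × c ≢ b × ¬ OnPath par a b u) ⊎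
                 (c ≡ b × ¬ IntervalAppendices par p W b u)

    branch-base-on-path : ∀ {u c} → Branch u c → OnPath par a b c
    branch-base-on-path (inj₁ (ac∧cb , _)) = ac∧cb
    branch-base-on-path (inj₂ (c≡b , _))   = subst (OnPath par a b) (sym c≡b) (ab , here)

    branch∉appendices : ∀ {u c} → par u ≡ just c → Branch u c → u ∉ W
    branch∉appendices uc (inj₁ ((_ , cb) , c≢b , _)) u∈W =
      c≢b (Anc-antisym forest cb (subst (Anc par b) (sym c≡p) bp))
      where c≡p = just-injective (trans (sym uc) (W-children _ u∈W))
    branch∉appendices uc (inj₂ (c≡b , u∉Wb)) u∈W =
      u∉Wb (inj₁ (trans (sym c≡b) (just-injective (trans (sym uc) (W-children _ u∈W))) , u∈W))

    branch-not-above-spine-end : ∀ {u c} → par u ≡ just c → Branch u c → ¬ Anc par u p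
    branch-not-above-spine-end {u} uc (inj₁ ((ac , cb) , c≢b , u∉P)) up with Anc-total up bp
    ... | inj₁ ub = u∉P (Anc-trans ac (step uc here) , ub)
    ... | inj₂ bu with Anc-parent bu uc
    ...   | inj₁ u≡b = u∉P (Anc-trans ac (step uc here) , subst (Anc par u) u≡b here)
    ...   | inj₂ bc  = c≢b (Anc-antisym forest cb bc)
    branch-not-above-spine-end {u} uc (inj₂ (c≡b , u∉Wb)) up with b ≟ p
    ... | yes b≡p = forest p u (subst (λ q → par u ≡ just q) (trans c≡b b≡p) uc) up
    ... | no  b≢p = u∉Wb (inj₂ (b≢p , subst (λ q → par u ≡ just q) c≡b uc , up))

XFree : ∀ {n} → (Fin n → Colour) → (Fin n → Set) → Set
XFree col S = ∀ w → S w → col w ≢ X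

module Colouring {n : ℕ} (H : Hypergraph n) (col : Fin n → Colour) (par : Parent n)
                 (proper : ProperPartition H col) (forest : IsForest par)
                 (reduced : IsReduced H par) where

  Adj-sameColour : ∀ {r z} → Adj H r z → col r ≢ X → col z ≢ X → col z ≡ col r
  Adj-sameColour {r} {z} (e , e∈H , r∈e , z∈e) r≢X z≢X with col r in cr | col z in cz
  ... | red  | red  = refl
  ... | blue | blue = refl
  ... | red  | blue = ⊥-elim (proper e∈H r z r∈e z∈e cr cz)
  ... | blue | red  = ⊥-elim (proper e∈H z r z∈e r∈e cz cr)
  ... | X    | _    = ⊥-elim (r≢X refl)
  ... | red  | X    = ⊥-elim (z≢X refl)
  ... | blue | X    = ⊥-elim (z≢X refl)

  child-colour : ∀ {u c} → par u ≡ just c → col c ≢ X → XFree col (Anc par u) →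
                 (∀ w → Anc par u w → col w ≡ col u) → col u ≡ col c
  child-colour uc c≢X u-XFree u-mono with reduced _ _ uc
  ... | z , uz , cz = trans (sym (u-mono z uz)) (Adj-sameColour cz c≢X (u-XFree z uz))

  subtree-monochromatic : ∀ {t} → XFree col (Anc par t) → ∀ w → Anc par t w → col w ≡ col t
  subtree-monochromatic {t} = go (descendant-wellFounded forest t)
    where
    go : ∀ {t} → Acc (flip StrictAnc) t → XFree col (Anc par t) → ∀ w → Anc par t w → col w ≡ col t
    go (acc rec) t-XFree w tw with Anc-viewˡ tw
    ... | inj₁ refl         = refl
    ... | inj₂ (c , e , cw) = trans (c-mono w cw) (child-colour e (t-XFree _ here) c-XFree c-mono)
      where
      c-XFree : XFree col (Anc par c)
      c-XFree v cv = t-XFree v (Anc-trans (step e here) cv)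
      c-mono : ∀ v → Anc par c v → col v ≡ col c
      c-mono = go (rec (_ , e , here)) c-XFree

  interval-factor-colour :
    ∀ {x p W} → (∀ y → y ∈ W → par y ≡ just p) → XFree col (ContextFactor par x W) →
    ∀ {a b} → Anc par x a → Anc par a b → Anc par b p →
    ∀ {κ} → (∀ w → OnPath par a b w → col w ≡ κ) →
    ∀ w → Cont par a b (IntervalAppendices par p W b) w → col w ≡ κ
  interval-factor-colour _ _ _ _ _ P-colour w (inj₁ w∈P) = P-colour w w∈P
  interval-factor-colour {x} {p} W-children U-XFree {a} {b} xa ab bp {κ} P-colour w (inj₂ (u , c , uw , uc , branch)) =
    begin
      col w  ≡⟨ u-mono w uw ⟩
      col u  ≡⟨ child-colour uc c≢X u-XFree u-mono ⟩
      col c  ≡⟨ P-colour c c∈P ⟩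
      κ      ∎
    where
    open ≡-Reasoning
    c∈P : OnPath par a b c
    c∈P = branch-base-on-path forest W-children ab bp branch
    xc : Anc par x c
    xc = Anc-trans xa (proj₁ c∈P)
    cp : Anc par c p
    cp = Anc-trans (proj₂ c∈P) bp
    c≢X : col c ≢ X
    c≢X = U-XFree c (above-spine-end∈factor forest W-children xc cp)
    u-XFree : XFree col (Anc par u)
    u-XFree v uv = U-XFree v (branch⊆factor forest W-children xc cp uc
      (branch∉appendices forest W-children ab bp uc branch)
      (branch-not-above-spine-end forest W-children ab bp uc branch) v uv)
    u-mono : ∀ v → Anc par u v → col v ≡ col u
    u-mono = subtree-monochromatic u-XFree

corollary22 : ∀ {n} (H : Hypergraph n) (col : Fin n → Colour) (par : Parent n) →
    ProperPartition H col →
    IsEliminationForest H par →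
    IsReduced H par →
    (x p : Fin n) (W : Subset n) →
    IsContextFactor par x p W →
    (∀ w → ContextFactor par x W w → col w ≢ X) →
    (a b : Fin n) →
    IsColourInterval par col x p a b →
    Monochromatic col (Cont par a b (IntervalAppendices par p W b))
corollary22 H col par proper (forest , _) reduced x p W (_ , W-children , _) U-XFree a b
  (xa , ab , bp , P-mono , _) =
  Sum.map (interval-factor-colour W-children U-XFree xa ab bp)
          (interval-factor-colour W-children U-XFree xa ab bp) P-mono
  where open Colouring H col par proper forest reduced
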